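{- Let $\tau$ be a co-quasiorder on a semigroup with apartness $S$. Then $\tau$ is co-compatible if and only if $\tau$ is both left co-compatible and right co-compatible.
   Context: Constructive (Bishop-style) setting. A set with apartness: inhabited set with equality $=$ and $\#$ with $\neg(x\#x)$, $x\#y\Rightarrow y\#x$, $x\#z\Rightarrow\forall y(x\#y\vee y\#z)$. A semigroup with apartness is a set with apartness with an associative operation satisfying $ax\#by\Rightarrow(a\#b\vee x\#y)$. A co-quasiorder is a relation $\tau$ with $(x,y)\in\tau\Rightarrow x\#y$ and $(x,y)\in\tau\Rightarrow\forall z((x,z)\in\tau\vee(z,y)\in\tau)$. $\tau$ is left co-compatible if $(zx,zy)\in\tau\Rightarrow(x,y)\in\tau$; right co-compatible if $(xz,yz)\in\tau\Rightarrow(x,y)\in\tau$; co-compatible if $(xz,yt)\in\tau\Rightarrow(x,y)\in\tau\vee(z,t)\in\tau$, for all $x,y,z,t\in S$. -}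

module Defs where

open import Level using (Level; _⊔_; suc)
open import Data.Product using (_×_; ∃)
open import Data.Sum using (_⊎_)
open import Relation.Nullary using (¬_)
open import Relation.Binary.Core using (Rel)
open import Relation.Binary.Structures using (IsEquivalence)

record SemigroupWithApartness (c ℓ₁ ℓ₂ : Level) : Set (suc (c ⊔ ℓ₁ ⊔ ℓ₂)) where
  infixl 7 _∙_
  infix 4 _≈_ _#_
  field
    Carrier   : Set c
    _≈_       : Rel Carrier ℓ₁
    _#_       : Rel Carrier ℓ₂
    _∙_       : Carrier → Carrier → Carrier
    inhabited : Carrier
    isEquivalence : IsEquivalence _≈_
    #-irrefl  : ∀ x → ¬ (x # x)
    #-sym     : ∀ {x y} → x # y → y # x
    #-cotrans : ∀ {x z} → x # z → ∀ y → (x # y) ⊎ (y # z)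
    #-resp-≈  : ∀ {x y z} → x # y → y ≈ z → x # z
    ∙-cong    : ∀ {a b x y} → a ≈ b → x ≈ y → (a ∙ x) ≈ (b ∙ y)
    assoc     : ∀ x y z → ((x ∙ y) ∙ z) ≈ (x ∙ (y ∙ z))
    ∙-strongExt : ∀ {a b x y} → (a ∙ x) # (b ∙ y) → (a # b) ⊎ (x # y)

module _ {c ℓ₁ ℓ₂ : Level} (S : SemigroupWithApartness c ℓ₁ ℓ₂) where
  open SemigroupWithApartness S

  record IsCoQuasiorder {ℓ} (τ : Rel Carrier ℓ) : Set (c ⊔ ℓ₂ ⊔ ℓ) where
    field
      consistent : ∀ {x y} → τ x y → x # y
      cotrans    : ∀ {x y} → τ x y → ∀ z → τ x z ⊎ τ z y

  LeftCoCompatible : ∀ {ℓ} → Rel Carrier ℓ → Set (c ⊔ ℓ)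
  LeftCoCompatible τ = ∀ x y z → τ (z ∙ x) (z ∙ y) → τ x y

  RightCoCompatible : ∀ {ℓ} → Rel Carrier ℓ → Set (c ⊔ ℓ)
  RightCoCompatible τ = ∀ x y z → τ (x ∙ z) (y ∙ z) → τ x y

  CoCompatible : ∀ {ℓ} → Rel Carrier ℓ → Set (c ⊔ ℓ)
  CoCompatible τ = ∀ x y z t → τ (x ∙ z) (y ∙ t) → τ x y ⊎ τ z t

{-# OPTIONS --safe #-}
module Submission where

-- Specialising co-compatibility to z = t (resp. x = y) gives the one-sided
-- versions, since τ is irreflexive. Conversely, cotransitivity splits
-- τ (xz) (yt) at xt into τ (xz) (xt) or τ (xt) (yt), and the one-sided
-- laws cancel the common factor.

open import Defs
open import Data.Product using (_×_; _,_)
open import Data.Sum using (_⊎_; inj₁; inj₂)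
open import Data.Empty using (⊥-elim)
open import Function.Bundles using (_⇔_; mk⇔)
open import Relation.Binary.Core using (Rel)
open import Relation.Nullary using (¬_)

module _ {c ℓ₁ ℓ₂ ℓ} (S : SemigroupWithApartness c ℓ₁ ℓ₂)
         {τ : Rel (SemigroupWithApartness.Carrier S) ℓ} where
  open SemigroupWithApartness S

  consistent⇒irreflexive : (∀ {x y} → τ x y → x # y) → ∀ x → ¬ τ x x
  consistent⇒irreflexive consistent x τxx = #-irrefl x (consistent τxx)

  coCompatible⇒leftCoCompatible :
    (∀ {x y} → τ x y → x # y) → CoCompatible S τ → LeftCoCompatible S τ
  coCompatible⇒leftCoCompatible consistent cc x y z τzxzy with cc z z x y τzxzy
  ... | inj₁ τzz = ⊥-elim (consistent⇒irreflexive consistent z τzz)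
  ... | inj₂ τxy = τxy

  coCompatible⇒rightCoCompatible :
    (∀ {x y} → τ x y → x # y) → CoCompatible S τ → RightCoCompatible S τ
  coCompatible⇒rightCoCompatible consistent cc x y z τxzyz with cc x y z z τxzyz
  ... | inj₁ τxy = τxy
  ... | inj₂ τzz = ⊥-elim (consistent⇒irreflexive consistent z τzz)

  leftRightCoCompatible⇒coCompatible :
    (∀ {x y} → τ x y → ∀ z → τ x z ⊎ τ z y) →
    LeftCoCompatible S τ → RightCoCompatible S τ → CoCompatible S τ
  leftRightCoCompatible⇒coCompatible cotrans left right x y z t τxzyt
    with cotrans τxzyt (x ∙ t)
  ... | inj₁ τxzxt = inj₂ (left z t x τxzxt)
  ... | inj₂ τxtyt = inj₁ (right x y t τxtyt)

lemma16 : ∀ {c ℓ₁ ℓ₂ ℓ} (S : SemigroupWithApartness c ℓ₁ ℓ₂)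
    (τ : Rel (SemigroupWithApartness.Carrier S) ℓ) →
    IsCoQuasiorder S τ →
    CoCompatible S τ ⇔ (LeftCoCompatible S τ × RightCoCompatible S τ)
lemma16 S τ isCoQuasiorder = mk⇔
  (λ cc → coCompatible⇒leftCoCompatible S consistent cc
        , coCompatible⇒rightCoCompatible S consistent cc)
  (λ (left , right) → leftRightCoCompatible⇒coCompatible S cotrans left right)
  where open IsCoQuasiorder isCoQuasiorder
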